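{- Let $X=\{1,\ldots,n\}$, let $\pi=(x_1,\ldots,x_n)$ be a circular ordering, and let $\delta$ be a dissimilarity map on $X$ satisfying the Kalmanson conditions with respect to $\pi$. Let $\mathcal{C}=\{C_1,\ldots,C_m\}$ be a partial circular ordering with a weighting $\mu$, consistent with $\pi$ in the sense that whenever $x_i\in C_r$, $x_j\in C_s$ and $r<s$, we have $i<j$. Then for every $1\le r<s<t<u\le m$, \[ \delta(C_r,C_s)+\delta(C_t,C_u)\le\delta(C_r,C_t)+\delta(C_s,C_u),\qquad \delta(C_r,C_u)+\delta(C_s,C_t)\le\delta(C_r,C_t)+\delta(C_s,C_u). \]
   Context: Dissimilarity map: a function $\delta:X\times X\to\mathbb{R}$ with $\delta(i,j)=\delta(j,i)\ge0$ and $\delta(i,i)=0$. Circular ordering: a bijection between $X$ and the vertices of the $n$-cycle, written $(x_1,\ldots,x_n)$. Kalmanson conditions with respect to $\pi$: for all $1\le i<j<k<l\le n$, $\delta(x_i,x_j)+\delta(x_k,x_l)\le\delta(x_i,x_k)+\delta(x_j,x_l)$ and $\delta(x_i,x_l)+\delta(x_j,x_k)\le\delta(x_i,x_k)+\delta(x_j,x_l)$. Partial circular ordering: a partition $\{C_1,\ldots,C_m\}$ of $X$ into blocks, each a path (linearly ordered). $\hat C_r$ denotes the endpoints of $C_r$: the single element if $|C_r|=1$, and the two ends otherwise. Weighting: a function $\mu:X\to\mathbb{R}_{\ge0}$ with $\sum_{i\in C_r}\mu(i)=1$ for each $r$ and $\mu(i)>0$ for $i\in\hat C_r$. Block dissimilarity: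 $\delta(C_r,C_s)=\sum_{i\in C_r,j\in C_s}\mu(i)\mu(j)\delta(i,j)$. -}

module Defs where

open import Level using (Level; _⊔_; suc)
open import Algebra.Bundles using (CommutativeRing)
open import Relation.Binary.Structures using (IsTotalOrder)
open import Relation.Nullary using (¬_)
open import Data.Nat using (ℕ)
open import Data.Fin using (Fin) renaming (_<_ to _<ᶠ_)
open import Data.List using (List; []; _∷_; map; foldr; head; last; concatMap)
open import Data.List.Relation.Unary.All using (All)
open import Data.List.Membership.Propositional using (_∈_)
open import Data.List.Relation.Binary.Permutation.Propositional using (_↭_)
open import Data.Fin.Base using () renaming (_<_ to _<F_)
open import Data.List.Base using () renaming (allFin to allFinL)
open import Data.Maybe using (just)
open import Data.Product using (_×_)
open import Data.Sum using (_⊎_)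
open import Function.Bundles using (_⤖_; Bijection)
open import Relation.Binary.PropositionalEquality using (_≡_; _≢_)

-- Real numbers are not available; we work over an arbitrary (totally)
-- ordered commutative ring, of which ℝ is an instance.
record OrderedCommutativeRing (c ℓ₁ ℓ₂ : Level) : Set (Level.suc (c ⊔ ℓ₁ ⊔ ℓ₂)) where
  field
    commutativeRing : CommutativeRing c ℓ₁
  open CommutativeRing commutativeRing public
  field
    _≤_          : Carrier → Carrier → Set ℓ₂
    isTotalOrder : IsTotalOrder _≈_ _≤_
    +-mono-≤     : ∀ {x y} z → x ≤ y → (x + z) ≤ (y + z)
    *-nonneg     : ∀ {x y} → 0# ≤ x → 0# ≤ y → 0# ≤ (x * y)

  _<_ : Carrier → Carrier → Set (ℓ₁ ⊔ ℓ₂)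
  x < y = (x ≤ y) × ¬ (x ≈ y)

module _ {c ℓ₁ ℓ₂ : Level} (R : OrderedCommutativeRing c ℓ₁ ℓ₂) where
  open OrderedCommutativeRing R

  sumR : List Carrier → Carrier
  sumR = foldr _+_ 0#

  IsDissimilarity : {n : ℕ} → (Fin n → Fin n → Carrier) → Set (ℓ₁ ⊔ ℓ₂)
  IsDissimilarity {n} δ =
    (∀ i j → δ i j ≈ δ j i) × (∀ i j → 0# ≤ δ i j) × (∀ i → δ i i ≈ 0#)

  Kalmanson : {n : ℕ} → (Fin n ⤖ Fin n) → (Fin n → Fin n → Carrier) → Set ℓ₂
  Kalmanson {n} π δ = ∀ (i j k l : Fin n) → i <F j → j <F k → k <F l →
      ((δ (x i) (x j) + δ (x k) (x l)) ≤ (δ (x i) (x k) + δ (x j) (x l)))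
    × ((δ (x i) (x l) + δ (x j) (x k)) ≤ (δ (x i) (x k) + δ (x j) (x l)))
    where x = Bijection.to π

  IsWeighting : {n m : ℕ} → (Fin m → List (Fin n)) → (Fin n → Carrier) → Set (ℓ₁ ⊔ ℓ₂)
  IsWeighting {n} {m} C μ =
      (∀ i → 0# ≤ μ i)
    × (∀ r → sumR (map μ (C r)) ≈ 1#)
    × (∀ r i → IsEndpoint (C r) i → 0# < μ i)
    where
      IsEndpoint : List (Fin n) → Fin n → Set
      IsEndpoint L i = (head L ≡ just i) ⊎ (last L ≡ just i)

  blockDiss : {n m : ℕ} → (Fin m → List (Fin n)) → (Fin n → Carrier) →
              (Fin n → Fin n → Carrier) → Fin m → Fin m → Carrier
  blockDiss C μ δ r s =
    sumR (map (λ i → sumR (map (λ j → (μ i * μ j) * δ i j) (C s))) (C r))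

-- partial circular ordering: blocks C_1..C_m, each a nonempty path (list in
-- path order), together partitioning X = Fin n (each element in exactly one block)
IsPartialCircularOrdering : {n m : ℕ} → (Fin m → List (Fin n)) → Set
IsPartialCircularOrdering {n} {m} C =
  (∀ r → C r ≢ []) × (concatMap C (allFinL m) ↭ allFinL n)

Consistent : {n m : ℕ} → (Fin n ⤖ Fin n) → (Fin m → List (Fin n)) → Set
Consistent {n} {m} π C = ∀ (i j : Fin n) (r s : Fin m) →
  Bijection.to π i ∈ C r → Bijection.to π j ∈ C s → r <F s → i <F j

module Submission where

-- Since every block carries total weight 1, δ(C_r, C_s) + δ(C_t, C_u) is the
-- average, with the product weights μ(a)μ(b)μ(c)μ(d) over C_r × C_s × C_t × C_u,
-- of δ(a,b) + δ(c,d), and likewise for the other pairings.  Consistency puts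
-- a, b, c, d in circular order, so the Kalmanson inequalities hold for every such
-- quadruple, and averaging with nonnegative weights preserves them.

open import Defs
open import Data.Nat using (ℕ)
open import Data.Fin using (Fin; _<_)
open import Data.List using (List; []; _∷_; map)
open import Data.List.Membership.Propositional using (_∈_)
open import Data.List.Relation.Unary.Any using (here; there)
open import Data.Product using (_×_; _,_; proj₁; proj₂)
open import Function.Bundles using (_⤖_; Bijection)
open import Relation.Binary.Bundles using (Poset)
open import Relation.Binary.Structures using (IsTotalOrder)
import Relation.Binary.PropositionalEquality as ≡
import Algebra.Properties.CommutativeSemigroup as CommutativeSemigroupProperties
import Algebra.Properties.Group as GroupProperties
import Relation.Binary.Reasoning.PartialOrder as PosetReasoning

module _ {c ℓ₁ ℓ₂} (R : OrderedCommutativeRing c ℓ₁ ℓ₂) where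
  open OrderedCommutativeRing R hiding (_<_) renaming (+-mono-≤ to +-monoˡ-≤)
  open CommutativeSemigroupProperties +-commutativeSemigroup using (interchange)
  open GroupProperties +-group using (//-rightDividesˡ)

  poset : Poset c ℓ₁ ℓ₂
  poset = record { isPartialOrder = IsTotalOrder.isPartialOrder isTotalOrder }

  open Poset poset using () renaming (refl to ≤-refl)
  open PosetReasoning poset

  +-mono-≤ : ∀ {a b x y} → a ≤ b → x ≤ y → (a + x) ≤ (b + y)
  +-mono-≤ {a} {b} {x} {y} a≤b x≤y = begin
    a + x  ≤⟨ +-monoˡ-≤ x a≤b ⟩
    b + x  ≈⟨ +-comm b x ⟩
    x + b  ≤⟨ +-monoˡ-≤ b x≤y ⟩
    y + b  ≈⟨ +-comm y b ⟩
    b + y  ∎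

  *-monoˡ-≤-nonNeg : ∀ {w x y} → 0# ≤ w → x ≤ y → (w * x) ≤ (w * y)
  *-monoˡ-≤-nonNeg {w} {x} {y} 0≤w x≤y = begin
    w * x                  ≈⟨ +-identityˡ (w * x) ⟨
    0# + w * x             ≤⟨ +-monoˡ-≤ (w * x) (*-nonneg 0≤w 0≤y-x) ⟩
    w * (y - x) + w * x    ≈⟨ distribˡ w (y - x) x ⟨
    w * ((y - x) + x)      ≈⟨ *-congˡ (//-rightDividesˡ x y) ⟩
    w * y                  ∎
    where
    0≤y-x : 0# ≤ (y - x)
    0≤y-x = begin
      0#     ≈⟨ -‿inverseʳ x ⟨
      x - x  ≤⟨ +-monoˡ-≤ (- x) x≤y ⟩
      y - x  ∎

  sumR-map-cong : {A : Set} (L : List A) {f g : A → Carrier} →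
                  (∀ a → f a ≈ g a) → sumR R (map f L) ≈ sumR R (map g L)
  sumR-map-cong []      f≈g = refl
  sumR-map-cong (a ∷ L) f≈g = +-cong (f≈g a) (sumR-map-cong L f≈g)

  sumR-map-+ : {A : Set} (L : List A) (f g : A → Carrier) →
               sumR R (map (λ a → f a + g a) L) ≈ sumR R (map f L) + sumR R (map g L)
  sumR-map-+ []      f g = sym (+-identityˡ 0#)
  sumR-map-+ (a ∷ L) f g =
    trans (+-congˡ (sumR-map-+ L f g)) (interchange (f a) (g a) _ _)

  sumR-map-*ˡ : {A : Set} (L : List A) (k : Carrier) (f : A → Carrier) →
                sumR R (map (λ a → k * f a) L) ≈ k * sumR R (map f L)
  sumR-map-*ˡ []      k f = sym (zeroʳ k)
  sumR-map-*ˡ (a ∷ L) k f =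
    trans (+-congˡ (sumR-map-*ˡ L k f)) (sym (distribˡ k (f a) _))

  sumR-map-mono : {A : Set} (L : List A) {f g : A → Carrier} →
                  (∀ a → a ∈ L → f a ≤ g a) → sumR R (map f L) ≤ sumR R (map g L)
  sumR-map-mono []      f≤g = ≤-refl
  sumR-map-mono (a ∷ L) f≤g =
    +-mono-≤ (f≤g a (here ≡.refl)) (sumR-map-mono L (λ b b∈L → f≤g b (there b∈L)))

  FourPoint : {B : Set} → (B → B → Carrier) → B → B → B → B → Set ℓ₂
  FourPoint D a b c d =
    ((D a b + D c d) ≤ (D a c + D b d)) × ((D a d + D b c) ≤ (D a c + D b d))

  FourPoint-resp-≈ : {B : Set} {D D′ : B → B → Carrier} → (∀ x y → D x y ≈ D′ x y) →
                     ∀ {a b c d} → FourPoint D′ a b c d → FourPoint D a b c d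
  FourPoint-resp-≈ {D = D} {D′} D≈D′ {a} {b} {c} {d} (ineq₁ , ineq₂) =
      resp (D≈D′ a b) (D≈D′ c d) ineq₁
    , resp (D≈D′ a d) (D≈D′ b c) ineq₂
    where
    resp : ∀ {x x′ y y′} → x ≈ x′ → y ≈ y′ → (x′ + y′) ≤ (D′ a c + D′ b d) →
           (x + y) ≤ (D a c + D b d)
    resp {x} {x′} {y} {y′} x≈x′ y≈y′ le = begin
      x + y              ≈⟨ +-cong x≈x′ y≈y′ ⟩
      x′ + y′            ≤⟨ le ⟩
      D′ a c + D′ b d    ≈⟨ +-cong (D≈D′ a c) (D≈D′ b d) ⟨
      D a c + D b d      ∎

  module WeightedAverage {A : Set} (μ : A → Carrier) where

    average : List A → (A → Carrier) → Carrier
    average L f = sumR R (map (λ a → μ a * f a) L)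

    average² : List A → List A → (A → A → Carrier) → Carrier
    average² K L φ = average K (λ a → average L (φ a))

    average-cong : ∀ L {f g} → (∀ a → f a ≈ g a) → average L f ≈ average L g
    average-cong L f≈g = sumR-map-cong L (λ a → *-congˡ (f≈g a))

    average-+ : ∀ L f g → average L (λ a → f a + g a) ≈ average L f + average L g
    average-+ L f g = trans (sumR-map-cong L (λ a → distribˡ (μ a) (f a) (g a))) (sumR-map-+ L _ _)

    average-const : ∀ L → sumR R (map μ L) ≈ 1# → ∀ k → average L (λ _ → k) ≈ k
    average-const L ΣL≈1 k = begin-equality
      average L (λ _ → k)              ≈⟨ sumR-map-cong L (λ a → *-comm (μ a) k) ⟩
      sumR R (map (λ a → k * μ a) L)   ≈⟨ sumR-map-*ˡ L k μ ⟩
      k * sumR R (map μ L)             ≈⟨ *-congˡ ΣL≈1 ⟩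
      k * 1#                           ≈⟨ *-identityʳ k ⟩
      k                                ∎

    average-mono : (∀ a → 0# ≤ μ a) → ∀ L {f g} → (∀ a → a ∈ L → f a ≤ g a) →
                   average L f ≤ average L g
    average-mono 0≤μ L f≤g = sumR-map-mono L (λ a a∈L → *-monoˡ-≤-nonNeg (0≤μ a) (f≤g a a∈L))

    product-weighted-sum≈average² : ∀ K L (φ : A → A → Carrier) →
      sumR R (map (λ a → sumR R (map (λ b → (μ a * μ b) * φ a b) L)) K) ≈ average² K L φ
    product-weighted-sum≈average² K L φ = sumR-map-cong K λ a →
      trans (sumR-map-cong L (λ b → *-assoc (μ a) (μ b) (φ a b))) (sumR-map-*ˡ L (μ a) _)

    module FourBlocks (K L M N : List A)
        (ΣK≈1 : sumR R (map μ K) ≈ 1#) (ΣL≈1 : sumR R (map μ L) ≈ 1#)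
        (ΣM≈1 : sumR R (map μ M) ≈ 1#) (ΣN≈1 : sumR R (map μ N) ≈ 1#) where

      average⁴ : (A → A → A → A → Carrier) → Carrier
      average⁴ f = average K λ a → average L λ b → average M λ c → average N λ d → f a b c d

      average⁴-+ : ∀ f g → average⁴ (λ a b c d → f a b c d + g a b c d) ≈ average⁴ f + average⁴ g
      average⁴-+ f g =
        trans (average-cong K λ a → trans (average-cong L λ b →
                 trans (average-cong M λ c → average-+ N _ _) (average-+ M _ _)) (average-+ L _ _))
              (average-+ K _ _)

      average⁴-mono : (∀ a → 0# ≤ μ a) → ∀ f g →
        (∀ a b c d → a ∈ K → b ∈ L → c ∈ M → d ∈ N → f a b c d ≤ g a b c d) →
        average⁴ f ≤ average⁴ g
      average⁴-mono 0≤μ f g f≤g =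
        average-mono 0≤μ K λ a a∈K → average-mono 0≤μ L λ b b∈L →
        average-mono 0≤μ M λ c c∈M → average-mono 0≤μ N λ d d∈N → f≤g a b c d a∈K b∈L c∈M d∈N

      module _ (φ : A → A → Carrier) where
        marginal₁₂ : average⁴ (λ a b c d → φ a b) ≈ average² K L φ
        marginal₁₂ = average-cong K λ a → average-cong L λ b →
          trans (average-cong M λ c → average-const N ΣN≈1 _) (average-const M ΣM≈1 _)

        marginal₃₄ : average⁴ (λ a b c d → φ c d) ≈ average² M N φ
        marginal₃₄ = trans (average-cong K λ a → average-const L ΣL≈1 _) (average-const K ΣK≈1 _)

        marginal₁₃ : average⁴ (λ a b c d → φ a c) ≈ average² K M φ
        marginal₁₃ = average-cong K λ a →
          trans (average-cong L λ b → average-cong M λ c → average-const N ΣN≈1 _)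
                (average-const L ΣL≈1 _)

        marginal₂₄ : average⁴ (λ a b c d → φ b d) ≈ average² L N φ
        marginal₂₄ = trans (average-cong K λ a → average-cong L λ b → average-const M ΣM≈1 _)
                           (average-const K ΣK≈1 _)

        marginal₁₄ : average⁴ (λ a b c d → φ a d) ≈ average² K N φ
        marginal₁₄ = average-cong K λ a →
          trans (average-cong L λ b → average-const M ΣM≈1 _) (average-const L ΣL≈1 _)

        marginal₂₃ : average⁴ (λ a b c d → φ b c) ≈ average² L M φ
        marginal₂₃ = trans (average-cong K λ a → average-cong L λ b → average-cong M λ c →
                              average-const N ΣN≈1 _)
                           (average-const K ΣK≈1 _)

      average²-FourPoint : (∀ a → 0# ≤ μ a) → (δ : A → A → Carrier) →
        (∀ a b c d → a ∈ K → b ∈ L → c ∈ M → d ∈ N → FourPoint δ a b c d) →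
        FourPoint (λ X Y → average² X Y δ) K L M N
      average²-FourPoint 0≤μ δ pointwise =
          (begin
            average² K L δ + average² M N δ        ≈⟨ split (marginal₁₂ δ) (marginal₃₄ δ) ⟨
            average⁴ (λ a b c d → δ a b + δ c d)   ≤⟨ average⁴-mono 0≤μ _ _ (λ a b c d a∈K b∈L c∈M d∈N →
                                                        proj₁ (pointwise a b c d a∈K b∈L c∈M d∈N)) ⟩
            average⁴ (λ a b c d → δ a c + δ b d)   ≈⟨ split (marginal₁₃ δ) (marginal₂₄ δ) ⟩
            average² K M δ + average² L N δ        ∎)
        , (begin
            average² K N δ + average² L M δ        ≈⟨ split (marginal₁₄ δ) (marginal₂₃ δ) ⟨
            average⁴ (λ a b c d → δ a d + δ b c)   ≤⟨ average⁴-mono 0≤μ _ _ (λ a b c d a∈K b∈L c∈M d∈N →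
                                                        proj₂ (pointwise a b c d a∈K b∈L c∈M d∈N)) ⟩
            average⁴ (λ a b c d → δ a c + δ b d)   ≈⟨ split (marginal₁₃ δ) (marginal₂₄ δ) ⟩
            average² K M δ + average² L N δ        ∎)
        where
        split : ∀ {f g x y} → average⁴ f ≈ x → average⁴ g ≈ y →
                average⁴ (λ a b c d → f a b c d + g a b c d) ≈ x + y
        split {f} {g} f≈x g≈y = trans (average⁴-+ f g) (+-cong f≈x g≈y)

  blockDiss-FourPoint : {n m : ℕ} (C : Fin m → List (Fin n)) (μ : Fin n → Carrier) →
    (∀ i → 0# ≤ μ i) → (∀ r → sumR R (map μ (C r)) ≈ 1#) → (δ : Fin n → Fin n → Carrier) →
    ∀ r s t u → (∀ a b c d → a ∈ C r → b ∈ C s → c ∈ C t → d ∈ C u → FourPoint δ a b c d) →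
    FourPoint (blockDiss R C μ δ) r s t u
  blockDiss-FourPoint C μ 0≤μ ΣC≈1 δ r s t u pointwise =
    FourPoint-resp-≈ (λ x y → product-weighted-sum≈average² (C x) (C y) δ)
      (average²-FourPoint (C r) (C s) (C t) (C u) (ΣC≈1 r) (ΣC≈1 s) (ΣC≈1 t) (ΣC≈1 u) 0≤μ δ pointwise)
    where open WeightedAverage μ
          open FourBlocks

  Kalmanson-FourPoint-blocks : {n m : ℕ} (π : Fin n ⤖ Fin n) (δ : Fin n → Fin n → Carrier)
    (C : Fin m → List (Fin n)) → Kalmanson R π δ → Consistent π C →
    ∀ {r s t u} → r < s → s < t → t < u →
    ∀ a b c d → a ∈ C r → b ∈ C s → c ∈ C t → d ∈ C u → FourPoint δ a b c d
  Kalmanson-FourPoint-blocks π δ C kalmanson consistent {r} {s} {t} {u} r<s s<t t<u a b c d a∈ b∈ c∈ d∈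
    with Bijection.strictlySurjective π a | Bijection.strictlySurjective π b
       | Bijection.strictlySurjective π c | Bijection.strictlySurjective π d
  ... | i , ≡.refl | j , ≡.refl | k , ≡.refl | l , ≡.refl =
    kalmanson i j k l (consistent i j r s a∈ b∈ r<s) (consistent j k s t b∈ c∈ s<t)
                      (consistent k l t u c∈ d∈ t<u)

mainTheorem7 : ∀ {c ℓ₁ ℓ₂} (R : OrderedCommutativeRing c ℓ₁ ℓ₂) (n m : ℕ)
    (π : Fin n ⤖ Fin n)
    (δ : Fin n → Fin n → OrderedCommutativeRing.Carrier R) →
    IsDissimilarity R δ → Kalmanson R π δ →
    (C : Fin m → List (Fin n)) → IsPartialCircularOrdering C →
    (μ : Fin n → OrderedCommutativeRing.Carrier R) → IsWeighting R C μ →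
    Consistent π C →
    ∀ (r s t u : Fin m) → r < s → s < t → t < u →
    let open OrderedCommutativeRing R
        D = blockDiss R C μ δ
    in ((D r s + D t u) ≤ (D r t + D s u)) × ((D r u + D s t) ≤ (D r t + D s u))
mainTheorem7 R n m π δ _ kalmanson C _ μ (0≤μ , ΣC≈1 , _) consistent r s t u r<s s<t t<u =
  blockDiss-FourPoint R C μ 0≤μ ΣC≈1 δ r s t u
    (Kalmanson-FourPoint-blocks R π δ C kalmanson consistent r<s s<t t<u)
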